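{- Let $\mathcal{N}$ be a $\oplus$-BAN and let $i,j$ be automata such that there is a path from $i$ to $j$ in the interaction graph of $\mathcal{N}$. Then for every configuration $x$ in which $i$ is unstable, there exists a configuration $x'$ reachable from $x$ by asynchronous updates in which $j$ is unstable.
   Context: A BAN on $V=\{1,\dots,n\}$ is a family $\{f_i\}$ of functions $\{0,1\}^n\to\{0,1\}$. Automaton $k$ is an influencer of $l$ if $f_l(x)\ne f_l(\overline{x}^k)$ for some $x$ ($\overline{x}^k$: $x$ with coordinate $k$ negated); the interaction graph has an arc $k\to l$ iff $k$ influences $l$. A $\oplus$-BAN is one where each $f_l(x)=\bigoplus_{k\in I_l}\sigma_{l,k}(x_k)$ with $I_l$ the influencers of $l$ and each $\sigma_{l,k}$ identity or negation. Automaton $l$ is unstable in $x$ if $f_l(x)\ne x_l$. An asynchronous update of automaton $l$ replaces $x_l$ by $f_l(x)$; $x'$ is reachable from $x$ if obtained by a finite (possibly empty) sequence of asynchronous updates. -}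

module Defs where

open import Data.Nat using (ℕ)
open import Data.Fin using (Fin; _≟_)
open import Data.Bool using (Bool; true; false; not; _xor_; if_then_else_)
open import Data.List using (List; foldr; filter)
open import Data.Fin.Base using ()
open import Data.List.Base using ()
open import Data.Product using (Σ; ∃; _×_; _,_)
open import Relation.Binary.PropositionalEquality using (_≡_; _≢_)
open import Relation.Nullary using (does)
open import Relation.Binary.Construct.Closure.ReflexiveTransitive using (Star)
open import Function.Bundles using (_⇔_)
import Data.List as L

Config : ℕ → Set
Config n = Fin n → Bool

BAN : ℕ → Set
BAN n = Fin n → Config n → Bool

negate : ∀ {n} → Fin n → Config n → Config n
negate k x i = if does (i ≟ k) then not (x i) else x i

Influences : ∀ {n} → BAN n → Fin n → Fin n → Set
Influences f k l = ∃ λ x → f l x ≢ f l (negate k x)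

Arc : ∀ {n} → BAN n → Fin n → Fin n → Set
Arc = Influences

Path : ∀ {n} → BAN n → Fin n → Fin n → Set
Path f = Star (Arc f)

xorOver : ∀ {n} → (Fin n → Bool) → (Fin n → Bool) → Bool
xorOver {n} I g = foldr (λ k b → (if I k then g k else false) xor b) false (L.allFin n)

-- ⊕-BAN: for each l, with I the set of influencers of l (given as characteristic
-- function) and σ_{l,k} = negation iff neg k ≡ true,
-- f_l(x) = ⊕_{k ∈ I} σ_{l,k}(x_k)
IsXorBAN : ∀ {n} → BAN n → Set
IsXorBAN {n} f = ∀ (l : Fin n) →
  Σ (Fin n → Bool) λ I → Σ (Fin n → Bool) λ neg →
    (∀ k → (I k ≡ true) ⇔ Influences f k l) ×
    (∀ x → f l x ≡ xorOver I (λ k → neg k xor x k))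

Unstable : ∀ {n} → BAN n → Fin n → Config n → Set
Unstable f l x = f l x ≢ x l

update : ∀ {n} → BAN n → Fin n → Config n → Config n
update f l x i = if does (i ≟ l) then f l x else x i

Step : ∀ {n} → BAN n → Config n → Config n → Set
Step f x y = ∃ λ l → y ≡ update f l x

Reachable : ∀ {n} → BAN n → Config n → Config n → Set
Reachable f = Star (Step f)

module Submission where

-- In a ⊕-BAN every local function f_l is a parity (xor) of literals over the
-- influencers of l.  Hence negating the state of one influencer k of l negates
-- f_l, whatever the rest of the configuration is (lemma xor-flip); this is
-- reduced to the fact that a finite parity flips when exactly one of its terms
-- flips (parity-negate).  Updating an unstable automaton i negates its state
-- and nothing else (update-unstable).  So if i is unstable in x and i → k is an
-- arc, either k is already unstable in x, or k is stable in x and updating i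
-- negates f_k while leaving x_k alone, making k unstable (instability-step).
-- The theorem follows by induction on the path from i to j, concatenating the
-- update sequences produced at every arc.

open import Defs
open import Data.Nat using (zero; suc)
open import Data.Fin using (Fin; zero; suc; _≟_)
open import Data.Bool using (Bool; false; not; _xor_; if_then_else_)
import Data.Bool as Bool
open import Data.Bool.Properties
  using (not-distribˡ-xor; not-distribʳ-xor; not-¬; ¬-not)
open import Data.List using (foldr; tabulate)
open import Data.Product using (∃; _×_; _,_)
open import Data.Empty using (⊥-elim)
open import Function using (_∘_; id)
open import Function.Bundles using (Equivalence)
open import Relation.Nullary using (yes; no)
open import Relation.Binary.PropositionalEquality
  using (_≡_; _≗_; refl; sym; cong; cong₂; module ≡-Reasoning)
open import Relation.Binary.Construct.Closure.ReflexiveTransitive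
  using (ε; _◅_; _◅◅_)

parity : ∀ n → (Fin n → Bool) → Bool
parity zero    t = false
parity (suc n) t = t zero xor parity n (t ∘ suc)

-- A right fold of xor over a tabulated list is the parity of the tabulated bits;
-- in particular this applies to the sum over `allFin n = tabulate id` in xorOver.
foldr-xor-tabulate : ∀ {m} n (t : Fin m → Bool) (g : Fin n → Fin m) →
  foldr (λ k b → t k xor b) false (tabulate g) ≡ parity n (t ∘ g)
foldr-xor-tabulate zero    t g = refl
foldr-xor-tabulate (suc n) t g =
  cong (t (g zero) xor_) (foldr-xor-tabulate n t (g ∘ suc))

parity-cong : ∀ n {t t' : Fin n → Bool} → t' ≗ t → parity n t' ≡ parity n t
parity-cong zero    e = refl
parity-cong (suc n) e = cong₂ _xor_ (e zero) (parity-cong n (e ∘ suc))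

parity-negate : ∀ n (k : Fin n) {t t' : Fin n → Bool} →
  t' ≗ negate k t → parity n t' ≡ not (parity n t)
parity-negate (suc n) zero {t} {t'} e = begin
  parity (suc n) t'                      ≡⟨ cong₂ _xor_ (e zero) (parity-cong n (e ∘ suc)) ⟩
  not (t zero) xor parity n (t ∘ suc)    ≡⟨ sym (not-distribˡ-xor (t zero) _) ⟩
  not (parity (suc n) t)                 ∎
  where open ≡-Reasoning
parity-negate (suc n) (suc k) {t} {t'} e = begin
  parity (suc n) t'                      ≡⟨ cong₂ _xor_ (e zero) (parity-negate n k (e ∘ suc)) ⟩
  t zero xor not (parity n (t ∘ suc))    ≡⟨ sym (not-distribʳ-xor (t zero) _) ⟩
  not (parity (suc n) t)                 ∎
  where open ≡-Reasoning

xor-flip : ∀ {n} (f : BAN n) → IsXorBAN f → ∀ {k l} → Influences f k l →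
  ∀ (x y : Config n) → y ≗ negate k x → f l y ≡ not (f l x)
xor-flip {n} f isXor {k} {l} k→l x y y≗kx with isXor l
... | I , neg , influencers , f-def = begin
  f l y                       ≡⟨ f-def y ⟩
  xorOver I (literal y)       ≡⟨ foldr-xor-tabulate n (term y) id ⟩
  parity n (term y)           ≡⟨ parity-negate n k term-negate ⟩
  not (parity n (term x))     ≡⟨ cong not (sym (foldr-xor-tabulate n (term x) id)) ⟩
  not (xorOver I (literal x)) ≡⟨ cong not (sym (f-def x)) ⟩
  not (f l x)                 ∎
  where
  open ≡-Reasoning
  literal : Config n → Fin n → Bool
  literal z m = neg m xor z m

  term : Config n → Fin n → Bool
  term z m = if I m then literal z m else false

  -- The terms of the parity differ exactly at k, where I k holds.
  term-negate : term y ≗ negate k (term x)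
  term-negate m with m ≟ k | y≗kx m
  ... | no _     | ym = cong (λ b → if I m then neg m xor b else false) ym
  ... | yes refl | ym
    rewrite Equivalence.from (influencers k) k→l | ym = sym (not-distribʳ-xor (neg k) (x k))

update-unstable : ∀ {n} (f : BAN n) {i} (x : Config n) → Unstable f i x →
  update f i x ≗ negate i x
update-unstable f {i} x unstable m with m ≟ i
... | yes refl = ¬-not unstable
... | no _     = refl

instability-step : ∀ {n} (f : BAN n) → IsXorBAN f → ∀ {i k} → Arc f i k →
  ∀ (x : Config n) → Unstable f i x →
  ∃ λ x' → Reachable f x x' × Unstable f k x'
instability-step f isXor {i} {k} i→k x unstable-i with f k x Bool.≟ x k | k ≟ i
... | no unstable-k | _        = x , ε , unstable-k
... | yes stable-k  | yes refl = ⊥-elim (unstable-i stable-k)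
... | yes stable-k  | no k≢i   = y , (i , refl) ◅ ε , unstable-k
  where
  y : Config _
  y = update f i x

  y-at-k : y k ≡ x k
  y-at-k with k ≟ i
  ... | yes k≡i = ⊥-elim (k≢i k≡i)
  ... | no _    = refl

  -- f_k is negated while x_k is unchanged.
  unstable-k : Unstable f k y
  unstable-k fky≡yk = not-¬ refl (begin
    x k           ≡⟨ sym y-at-k ⟩
    y k           ≡⟨ sym fky≡yk ⟩
    f k y         ≡⟨ xor-flip f isXor i→k x y (update-unstable f x unstable-i) ⟩
    not (f k x)   ≡⟨ cong not stable-k ⟩
    not (x k)     ∎)
    where open ≡-Reasoning

lemma3 : ∀ {n} (f : BAN n) → IsXorBAN f → (i j : Fin n) → Path f i j →
    ∀ (x : Config n) → Unstable f i x →
    ∃ λ x' → Reachable f x x' × Unstable f j x'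
lemma3 f isXor i .i ε x unstable = x , ε , unstable
lemma3 f isXor i j (_◅_ {j = k} i→k k⇝j) x unstable-i
  with instability-step f isXor i→k x unstable-i
... | x₁ , x⇝x₁ , unstable-k with lemma3 f isXor k j k⇝j x₁ unstable-k
... | x₂ , x₁⇝x₂ , unstable-j = x₂ , x⇝x₁ ◅◅ x₁⇝x₂ , unstable-j
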